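{- Let $p$ be a prime and $m\geq 0$ an integer, and suppose $A\subseteq\mathbb{Z}_p$ satisfies $A+[0,m]=\mathbb{Z}_p$. Then there is a subset $A'\subseteq A$ with $|A'|\leq 2\left\lceil\frac{p+1}{m+2}\right\rceil-1$ and $A'+[0,m]=\mathbb{Z}_p$.
   Context: $\mathbb{Z}_p=\mathbb{Z}/p\mathbb{Z}$; $[0,m]$ denotes the set of residues modulo $p$ of the integers $0,1,\dots,m$, and $X+Y=\{x+y:x\in X,y\in Y\}$. -}

module Defs where

open import Data.Nat using (ℕ; suc; _+_; _∸_; _≤_; NonZero)
open import Data.Nat.DivMod using (_/_; _%_)
open import Data.Fin using (Fin; toℕ)
open import Data.Fin.Subset using (Subset; _∈_)
open import Data.Product using (Σ; _×_)
open import Relation.Binary.PropositionalEquality using (_≡_)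

⌈_/_⌉ : (a b : ℕ) → .{{NonZero b}} → ℕ
⌈ a / b ⌉ = (a + (b ∸ 1)) / b

Covers : (p : ℕ) → .{{NonZero p}} → (m : ℕ) → Subset p → Set
Covers p m A = ∀ (z : Fin p) →
  Σ (Fin p) λ a → Σ ℕ λ j → (a ∈ A) × (j ≤ m) × (((toℕ a + j) % p) ≡ toℕ z)

module Submission where

-- Lift the problem from ℤ_p to the integers: a natural
-- number s "is in A" when its residue s mod p lies in A.  The covering
-- hypothesis A + [0,m] = ℤ_p says exactly that every integer window
-- [y, y+m] contains such a point.  Starting from a point a₀ of A we run
-- the greedy algorithm on the interval [a₀, a₀ + p): from the current
-- point u jump to the LARGEST point of A in [0, u+m+1].  By maximality,
-- two greedy steps always move past u + m + 1, i.e. by at least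
-- D = m + 2.  Writing E x = ⌊(a₀ + p − x)/D⌋, this gives the invariant
--   length of the chain from u ≤ n  whenever  2·E u ≤ n  and
--   1 + 2·E (next u) ≤ n,
-- so the chain has at most 2⌊p/D⌋ + 1 = 2⌈(p+1)/D⌉ − 1 points.  Every
-- integer in [a₀, a₀ + p) lies in some g + [0,m] with g in the chain,
-- and these integers represent all of ℤ_p, so the residues of the chain
-- form the required subset A′.

open import Defs
open import Data.Nat using (ℕ; zero; suc; _+_; _*_; _∸_; _≤_; _<_; NonZero; pred; z≤n; s≤s; s≤s⁻¹; _≤?_; _<?_)
open import Data.Nat.Properties
open import Data.Nat.DivMod using (_/_; _%_; %-distribˡ-+; m%n%n≡m%n; [m+kn]%n≡m%n; [m+n]%n≡m%n; m%n<n; m<n⇒m%n≡m; /-monoˡ-≤; m/n≡1+[m∸n]/n)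
open import Data.Nat.Primality using (Prime)
open import Data.Fin using (Fin; toℕ; fromℕ<)
open import Data.Fin.Properties using (toℕ-injective; toℕ-fromℕ<; toℕ<n)
open import Data.Fin.Subset using (Subset; _⊆_; ∣_∣; _∪_; ⁅_⁆; ⊥; _∈_)
open import Data.Fin.Subset.Properties using (_∈?_; x∈p∪q⁻; x∈p∪q⁺; x∈⁅y⁆⇒x≡y; x∈⁅x⁆; ∉⊥; ∣⊥∣≡0; ∣⁅x⁆∣≡1)
open import Data.Bool using (true; false)
open import Data.Vec using ([]; _∷_)
open import Data.List using (List; []; _∷_; [_]; length; map; foldr)
open import Data.List.Properties using (length-map)
open import Data.List.Relation.Unary.All using (All; []; _∷_)
open import Data.List.Relation.Unary.All.Properties using (map⁺)
open import Data.List.Relation.Unary.Any using (here; there)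
open import Data.List.Membership.Propositional using () renaming (_∈_ to _∈ₗ_)
open import Data.List.Membership.Propositional.Properties using (∈-map⁺)
open import Data.Product using (Σ; _×_; _,_; proj₁)
open import Data.Sum using (inj₁; inj₂)
open import Relation.Nullary using (yes; no; contradiction)
open import Relation.Unary using (Decidable)
open import Relation.Binary.PropositionalEquality using (_≡_; refl; sym; trans; cong; subst; module ≡-Reasoning)

greatestBelow : {P : ℕ → Set} → Decidable P → ∀ x {s} → P s → s ≤ x →
                Σ ℕ λ w → P w × w ≤ x × (∀ {t} → P t → t ≤ x → t ≤ w)
greatestBelow P? x ps s≤x with P? x
... | yes px = x , px , ≤-refl , λ _ t≤x → t≤x
greatestBelow P? zero ps z≤n | no ¬p0 = contradiction ps ¬p0
greatestBelow {P} P? (suc x) ps s≤x | no ¬px =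
  let w , pw , w≤x , maximal = greatestBelow P? x ps (belowTop ps s≤x) in
  w , pw , m≤n⇒m≤1+n w≤x , λ pt t≤x → maximal pt (belowTop pt t≤x)
  where
  -- since suc x itself is not in P, witnesses ≤ suc x are ≤ x
  belowTop : ∀ {t} → P t → t ≤ suc x → t ≤ x
  belowTop pt t≤x = s≤s⁻¹ (≤∧≢⇒< t≤x λ { refl → ¬px pt })

CoversInterval : ℕ → List ℕ → ℕ → ℕ → Set
CoversInterval m L u T =
  ∀ {x} → u ≤ x → x < T → Σ ℕ λ g → g ∈ₗ L × g ≤ x × x ≤ g + m

module Greedy {P : ℕ → Set} (P? : Decidable P) (m : ℕ)
  (window : ∀ y → Σ ℕ λ s → P s × y ≤ s × s ≤ y + m) where

  -- Minimal distance between the two-step successors of a greedy chain.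
  D : ℕ
  D = suc (suc m)

  -- The window [u + 1, u + 1 + m] provides a witness below u + m + 1.
  private
    largest : ∀ u → Σ ℕ λ w → P w × w ≤ suc u + m × (∀ {t} → P t → t ≤ suc u + m → t ≤ w)
    largest u = let s , ps , _ , s≤ = window (suc u) in greatestBelow P? (suc u + m) ps s≤

  next : ℕ → ℕ
  next u = proj₁ (largest u)

  next-P : ∀ u → P (next u)
  next-P u = let _ , pw , _ = largest u in pw

  next-≤ : ∀ u → next u ≤ suc u + m
  next-≤ u = let _ , _ , w≤ , _ = largest u in w≤

  next-maximal : ∀ u {t} → P t → t ≤ suc u + m → t ≤ next u
  next-maximal u = let _ , _ , _ , maximal = largest u in maximal

  -- The window [u + 1, u + 1 + m] contains a point, so the chain increases.
  next-> : ∀ u → u < next u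
  next-> u = let s , ps , u<s , s≤ = window (suc u) in ≤-trans u<s (next-maximal u ps s≤)

  -- Two greedy steps overshoot the whole window of u: otherwise
  -- next (next u) would have been a larger choice than next u.
  next²-far : ∀ u → suc u + m < next (next u)
  next²-far u = ≰⇒> λ nn≤ →
    <⇒≱ (next-> (next u)) (next-maximal u (next-P (next u)) nn≤)

  module Chain (T : ℕ) where

    -- chain k u: u, next u, next (next u), ... until the window of the
    -- current point reaches T; the fuel k suffices once T ≤ u + k.
    chain : ℕ → ℕ → List ℕ
    chain zero u = [ u ]
    chain (suc k) u with T ≤? suc u + m
    ... | yes _ = [ u ]
    ... | no _ = u ∷ chain k (next u)

    chain-P : ∀ k {u} → P u → All P (chain k u)
    chain-P zero pu = pu ∷ []
    chain-P (suc k) {u} pu with T ≤? suc u + m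
    ... | yes _ = pu ∷ []
    ... | no _ = pu ∷ chain-P k (next-P u)

    -- Since the chain increases, one unit of fuel is used per step.
    fuel-step : ∀ k u → T ≤ u + suc k → T ≤ next u + k
    fuel-step k u T≤ = ≤-trans T≤ (≤-trans (≤-reflexive (+-suc u k)) (+-monoˡ-≤ k (next-> u)))

    -- Each point u of the chain covers [u, next u) (or [u, T) at the end).
    chain-covers : ∀ k u → T ≤ u + k → CoversInterval m (chain k u) u T
    chain-covers zero u T≤u u≤x x<T =
      contradiction u≤x (<⇒≱ (≤-trans x<T (≤-trans T≤u (≤-reflexive (+-identityʳ u)))))
    chain-covers (suc k) u T≤ {x} u≤x x<T with T ≤? suc u + m
    ... | yes T≤end = u , here refl , u≤x , s≤s⁻¹ (≤-trans x<T T≤end)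
    ... | no _ with x <? next u
    ...   | yes x<next = u , here refl , u≤x , s≤s⁻¹ (≤-trans x<next (next-≤ u))
    ...   | no x≮next =
      let g , g∈ , covered = chain-covers k (next u) (fuel-step k u T≤) (≮⇒≥ x≮next) x<T in
      g , there g∈ , covered

    E : ℕ → ℕ
    E x = (T ∸ x) / D

    E-antitone : ∀ {u w} → u ≤ w → E w ≤ E u
    E-antitone {u} u≤w = /-monoˡ-≤ D (∸-monoʳ-≤ T u≤w)

    E-step : ∀ {u} → suc u + m < T → E u ≡ suc (E (suc (suc u + m)))
    E-step {u} far = begin
      (T ∸ u) / D             ≡⟨ m/n≡1+[m∸n]/n D≤T∸u ⟩
      suc ((T ∸ u ∸ D) / D)   ≡⟨ cong (λ n → suc (n / D)) (∸-+-assoc T u D) ⟩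
      suc ((T ∸ (u + D)) / D) ≡⟨ cong (λ n → suc ((T ∸ n) / D)) u+D≡ ⟩
      suc (E (suc (suc u + m))) ∎
      where
      open ≡-Reasoning
      u+D≡ : u + D ≡ suc (suc u + m)
      u+D≡ = trans (+-suc u (suc m)) (cong suc (+-suc u m))
      D≤T∸u : D ≤ T ∸ u
      D≤T∸u = m+n≤o⇒m≤o∸n D (subst (_≤ T) (trans (sym u+D≡) (+-comm u D)) far)

    E-next² : ∀ {u} → suc u + m < T → suc (E (next (next u))) ≤ E u
    E-next² far = ≤-trans (s≤s (E-antitone (next²-far _))) (≤-reflexive (sym (E-step far)))

    -- The length invariant: two steps of the chain consume one unit of E.
    chain-length : ∀ k u {n} → 2 * E u ≤ n → suc (2 * E (next u)) ≤ n →
                   length (chain k u) ≤ n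
    chain-length zero u _ (s≤s _) = s≤s z≤n
    chain-length (suc k) u {suc n} 2Eu≤ (s≤s 2Enext≤) with T ≤? suc u + m
    ... | yes _ = s≤s z≤n
    ... | no T≰ = s≤s (chain-length k (next u) 2Enext≤ (s≤s⁻¹ 2+2Enn≤))
      where
      2+2Enn≤ : suc (suc (2 * E (next (next u)))) ≤ suc n
      2+2Enn≤ = ≤-trans (≤-reflexive (sym (*-suc 2 _)))
                        (≤-trans (*-monoʳ-≤ 2 (E-next² (≰⇒> T≰))) 2Eu≤)

  greedyCover : ∀ a len → P a →
    Σ (List ℕ) λ L → All P L × length L ≤ suc (2 * (len / D)) × CoversInterval m L a (a + len)
  greedyCover a len pa =
    chain len a , chain-P len pa , length-bound , chain-covers len a ≤-refl
    where
    open Chain (a + len)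
    E-start : E a ≡ len / D
    E-start = cong (_/ D) (m+n∸m≡n a len)
    length-bound : length (chain len a) ≤ suc (2 * (len / D))
    length-bound = subst (λ e → length (chain len a) ≤ suc (2 * e)) E-start
      (chain-length len a (n≤1+n _) (s≤s (*-monoʳ-≤ 2 (E-antitone (<⇒≤ (next-> a))))))

∣p∪q∣≤∣p∣+∣q∣ : ∀ {n} (p q : Subset n) → ∣ p ∪ q ∣ ≤ ∣ p ∣ + ∣ q ∣
∣p∪q∣≤∣p∣+∣q∣ [] [] = z≤n
∣p∪q∣≤∣p∣+∣q∣ (true ∷ p) (true ∷ q) = s≤s (≤-trans (∣p∪q∣≤∣p∣+∣q∣ p q) (+-monoʳ-≤ ∣ p ∣ (n≤1+n _)))
∣p∪q∣≤∣p∣+∣q∣ (true ∷ p) (false ∷ q) = s≤s (∣p∪q∣≤∣p∣+∣q∣ p q)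
∣p∪q∣≤∣p∣+∣q∣ (false ∷ p) (true ∷ q) = ≤-trans (s≤s (∣p∪q∣≤∣p∣+∣q∣ p q)) (≤-reflexive (sym (+-suc _ _)))
∣p∪q∣≤∣p∣+∣q∣ (false ∷ p) (false ∷ q) = ∣p∪q∣≤∣p∣+∣q∣ p q

fromList : ∀ {n} → List (Fin n) → Subset n
fromList = foldr (λ x B → ⁅ x ⁆ ∪ B) ⊥

∈-fromList : ∀ {n} {x : Fin n} {xs} → x ∈ₗ xs → x ∈ fromList xs
∈-fromList (here refl) = x∈p∪q⁺ (inj₁ (x∈⁅x⁆ _))
∈-fromList (there x∈) = x∈p∪q⁺ (inj₂ (∈-fromList x∈))

fromList-⊆ : ∀ {n} {A : Subset n} {xs} → All (_∈ A) xs → fromList xs ⊆ A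
fromList-⊆ [] y∈ = contradiction y∈ ∉⊥
fromList-⊆ {xs = x ∷ xs} (x∈A ∷ xs⊆A) y∈ with x∈p∪q⁻ ⁅ x ⁆ (fromList xs) y∈
... | inj₁ y∈⁅x⁆ = subst (_∈ _) (sym (x∈⁅y⁆⇒x≡y x y∈⁅x⁆)) x∈A
... | inj₂ y∈rest = fromList-⊆ xs⊆A y∈rest

∣fromList∣≤length : ∀ {n} (xs : List (Fin n)) → ∣ fromList xs ∣ ≤ length xs
∣fromList∣≤length {n} [] = ≤-reflexive (∣⊥∣≡0 n)
∣fromList∣≤length (x ∷ xs) = ≤-trans (∣p∪q∣≤∣p∣+∣q∣ ⁅ x ⁆ (fromList xs))
  (+-mono-≤ (≤-reflexive (∣⁅x⁆∣≡1 x)) (∣fromList∣≤length xs))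

∣fromList-map∣≤length : ∀ {n} {B : Set} (f : B → Fin n) xs → ∣ fromList (map f xs) ∣ ≤ length xs
∣fromList-map∣≤length f xs = ≤-trans (∣fromList∣≤length (map f xs)) (≤-reflexive (length-map f xs))

module Residues (p : ℕ) .{{_ : NonZero p}} where

  residue : ℕ → Fin p
  residue s = fromℕ< (m%n<n s p)

  toℕ-residue : ∀ s → toℕ (residue s) ≡ s % p
  toℕ-residue s = toℕ-fromℕ< (m%n<n s p)

  residue-toℕ : ∀ (a : Fin p) → residue (toℕ a) ≡ a
  residue-toℕ a = toℕ-injective (trans (toℕ-residue (toℕ a)) (m<n⇒m%n≡m (toℕ<n a)))

  -- Congruence modulo p is preserved by adding a constant ...
  %-+-congʳ : ∀ {x y} k → x % p ≡ y % p → (x + k) % p ≡ (y + k) % p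
  %-+-congʳ {x} {y} k eq = begin
    (x + k) % p             ≡⟨ %-distribˡ-+ x k p ⟩
    (x % p + k % p) % p     ≡⟨ cong (λ r → (r + k % p) % p) eq ⟩
    (y % p + k % p) % p     ≡⟨ %-distribˡ-+ y k p ⟨
    (y + k) % p             ∎
    where open ≡-Reasoning

  -- ... and reflected by it, since adding j (p − 1) undoes adding j.
  %-+-cancelʳ : ∀ x y j → (x + j) % p ≡ (y + j) % p → x % p ≡ y % p
  %-+-cancelʳ x y j eq = begin
    x % p                       ≡⟨ [m+kn]%n≡m%n x j p ⟨
    (x + j * p) % p             ≡⟨ cong (_% p) (shift x) ⟩
    (x + j + j * pred p) % p    ≡⟨ %-+-congʳ (j * pred p) eq ⟩
    (y + j + j * pred p) % p    ≡⟨ cong (_% p) (shift y) ⟨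
    (y + j * p) % p             ≡⟨ [m+kn]%n≡m%n y j p ⟩
    y % p                       ∎
    where
    open ≡-Reasoning
    shift : ∀ z → z + j * p ≡ z + j + j * pred p
    shift z = begin
      z + j * p                 ≡⟨ cong (λ q → z + j * q) (suc-pred p) ⟨
      z + j * suc (pred p)      ≡⟨ cong (z +_) (*-suc j (pred p)) ⟩
      z + (j + j * pred p)      ≡⟨ +-assoc z j (j * pred p) ⟨
      z + j + j * pred p        ∎

  window : ∀ {m A} → Covers p m A → ∀ y →
           Σ ℕ λ s → residue s ∈ A × y ≤ s × s ≤ y + m
  window {m} {A} cover y =
    let a , j , a∈A , j≤m , a+j≡ = cover (residue (y + m))
        j≤y+m : j ≤ y + m
        j≤y+m = ≤-trans j≤m (m≤n+m m y)
        s+j≡ : (y + m ∸ j) + j ≡ y + m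
        s+j≡ = m∸n+n≡m j≤y+m
        s≡a : residue (y + m ∸ j) ≡ a
        s≡a = toℕ-injective (begin
          toℕ (residue (y + m ∸ j))  ≡⟨ toℕ-residue (y + m ∸ j) ⟩
          (y + m ∸ j) % p            ≡⟨ %-+-cancelʳ (y + m ∸ j) (toℕ a) j (begin
              ((y + m ∸ j) + j) % p       ≡⟨ cong (_% p) s+j≡ ⟩
              (y + m) % p                 ≡⟨ toℕ-residue (y + m) ⟨
              toℕ (residue (y + m))       ≡⟨ a+j≡ ⟨
              (toℕ a + j) % p             ∎) ⟩
          toℕ a % p                  ≡⟨ m<n⇒m%n≡m (toℕ<n a) ⟩
          toℕ a                      ∎)
    in  y + m ∸ j , subst (_∈ A) (sym s≡a) a∈A
      , subst (y ≤_) (sym (+-∸-assoc y j≤m)) (m≤m+n y (m ∸ j)) , m∸n≤m (y + m) j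
    where open ≡-Reasoning

  representative : ∀ {a} → a < p → (z : Fin p) →
                   Σ ℕ λ n → a ≤ n × n < a + p × n % p ≡ toℕ z
  representative {a} a<p z with a ≤? toℕ z
  ... | yes a≤z = toℕ z , a≤z , ≤-trans (toℕ<n z) (m≤n+m p a) , m<n⇒m%n≡m (toℕ<n z)
  ... | no a≰z  = toℕ z + p , ≤-trans (<⇒≤ a<p) (m≤n+m p (toℕ z)) , +-monoˡ-< p (≰⇒> a≰z)
                , trans ([m+n]%n≡m%n (toℕ z) p) (m<n⇒m%n≡m (toℕ<n z))

  residue-+ : ∀ g j → (toℕ (residue g) + j) % p ≡ (g + j) % p
  residue-+ g j = %-+-congʳ j (trans (cong (_% p) (toℕ-residue g)) (m%n%n≡m%n g p))

  intervalCover⇒Covers : ∀ {m} (a₀ : Fin p) L → CoversInterval m L (toℕ a₀) (toℕ a₀ + p) →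
                         Covers p m (fromList (map residue L))
  intervalCover⇒Covers {m} a₀ L coversL z =
    let n , a₀≤n , n< , n≡z = representative (toℕ<n a₀) z
        g , g∈L , g≤n , n≤g+m = coversL a₀≤n n<
    in  residue g , n ∸ g , ∈-fromList (∈-map⁺ residue g∈L)
      , ≤-trans (∸-monoˡ-≤ g n≤g+m) (≤-reflexive (m+n∸m≡n g m))
      , trans (residue-+ g (n ∸ g)) (trans (cong (_% p) (m+[n∸m]≡n g≤n)) n≡z)

ceil-bound : ∀ p m → 2 * ⌈ p + 1 / suc (suc m) ⌉ ∸ 1 ≡ suc (2 * (p / suc (suc m)))
ceil-bound p m = begin
  2 * ((p + 1 + suc m) / D) ∸ 1   ≡⟨ cong (λ n → 2 * (n / D) ∸ 1) p+D≡ ⟨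
  2 * ((p + D) / D) ∸ 1           ≡⟨ cong (λ n → 2 * n ∸ 1) (m/n≡1+[m∸n]/n (m≤n+m D p)) ⟩
  2 * suc ((p + D ∸ D) / D) ∸ 1   ≡⟨ cong (λ n → 2 * suc (n / D) ∸ 1) (m+n∸n≡m p D) ⟩
  2 * suc (p / D) ∸ 1             ≡⟨ +-suc (p / D) (p / D + 0) ⟩
  suc (2 * (p / D))               ∎
  where
  open ≡-Reasoning
  D : ℕ
  D = suc (suc m)
  p+D≡ : p + D ≡ p + 1 + suc m
  p+D≡ = trans (+-suc p (suc m)) (cong (_+ suc m) (+-comm 1 p))

smallSubcover : (p : ℕ) → .{{_ : NonZero p}} → (m : ℕ) → (A : Subset p) →
  Covers p m A →
  Σ (Subset p) λ A′ → (A′ ⊆ A) × (∣ A′ ∣ ≤ suc (2 * (p / suc (suc m)))) × Covers p m A′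
smallSubcover p m A cover =
  let L , L⊆A , length≤ , coversL = greedyCover (toℕ a₀) p a₀∈A in
  fromList (map residue L) , fromList-⊆ (map⁺ L⊆A)
  , ≤-trans (∣fromList-map∣≤length residue L) length≤ , intervalCover⇒Covers a₀ L coversL
  where
  open Residues p
  open Greedy (λ s → residue s ∈? A) m (window cover)
  a₀ : Fin p
  a₀ = residue (proj₁ (window cover 0))
  a₀∈A : residue (toℕ a₀) ∈ A
  a₀∈A = let _ , s∈A , _ = window cover 0 in subst (_∈ A) (sym (residue-toℕ a₀)) s∈A

lemma10 : (p : ℕ) → .{{_ : NonZero p}} → Prime p → (m : ℕ) → (A : Subset p) →
    Covers p m A →
    Σ (Subset p) λ A′ → (A′ ⊆ A) × (∣ A′ ∣ ≤ 2 * ⌈ p + 1 / suc (suc m) ⌉ ∸ 1) × Covers p m A′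
lemma10 p _ m A cover =
  let A′ , A′⊆A , size , A′-covers = smallSubcover p m A cover in
  A′ , A′⊆A , subst (∣ A′ ∣ ≤_) (sym (ceil-bound p m)) size , A′-covers
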